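{- Let $n$ be a positive integer. Then every balanced rooted binary phylogenetic tree $\mathcal T$ on $2^{n-1}$ leaves embeds $2^{\lfloor n-\log_2 n-1\rfloor}$ label-disjoint $n$-caterpillars; that is, there exist pairwise disjoint subsets $Y_1,\ldots,Y_{m}$ of the leaf set of $\mathcal T$, with $m=2^{\lfloor n-\log_2 n-1\rfloor}$ and $|Y_s|=n$ for each $s$, such that each restriction $\mathcal T|Y_s$ is an $n$-caterpillar.
   Context: A rooted binary phylogenetic $X$-tree is a rooted tree with leaves labelled bijectively by the finite set $X$, with root of degree two and other interior vertices of degree three (or a single vertex if $|X|=1$). It is balanced if $|X|=2^m$ and its height (number of edges on a longest root-to-leaf path) is $m$. For $Y\subseteq X$, the restriction $\mathcal T|Y$ is obtained from the minimal subtree of $\mathcal T$ connecting the leaves in $Y$ by suppressing non-root degree-two vertices. An $n$-caterpillar is a rooted binary phylogenetic tree with $n$ leaves that is either a single leaf ($n=1$) or whose leaves can be ordered $l_1,\ldots,l_n$ such that $l_1,l_2$ have the same parent and, for each $i\in\{2,\ldots,n-1\}$, the parent of $l_{i+1}$ is the parent of the parent of $l_i$. -}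

module Defs where

import Level
open import Data.Nat using (ℕ; zero; suc; _⊔_)
open import Data.Bool using (Bool; true; false; if_then_else_)
open import Data.Maybe using (Maybe; just; nothing)
open import Data.List using (List; []; _∷_; _++_; length)
open import Data.Product using (_×_)
open import Data.Sum using (_⊎_)
open import Relation.Nullary using (Dec; yes; no)
open import Relation.Unary using (Pred; Decidable)
open import Relation.Binary.PropositionalEquality using (_≡_)
open import Data.List.Relation.Unary.Unique.Propositional using (Unique)

-- A rooted binary phylogenetic X-tree is such a tree whose leaf labels are
-- pairwise distinct (the leaf set X is then the set of labels occurring).
data Tree (A : Set) : Set where
  leaf : A → Tree A
  node : Tree A → Tree A → Tree A

leaves : {A : Set} → Tree A → List A
leaves (leaf a)   = a ∷ []
leaves (node l r) = leaves l ++ leaves r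

height : {A : Set} → Tree A → ℕ
height (leaf _)   = 0
height (node l r) = suc (height l ⊔ height r)

IsPhylogenetic : {A : Set} → Tree A → Set
IsPhylogenetic t = Unique (leaves t)

IsBalanced : {A : Set} → ℕ → Tree A → Set
IsBalanced m t = length (leaves t) ≡ 2 Data.Nat.^ m × height t ≡ m

-- Restriction T|Y for a decidable subset Y of labels: minimal subtree
-- connecting the leaves in Y with non-root degree-two vertices suppressed.
restrict : {A : Set} {Y : Pred A Level.zero} → Decidable Y → Tree A → Maybe (Tree A)
restrict Y? (leaf a) with Y? a
... | yes _ = just (leaf a)
... | no _  = nothing
restrict Y? (node l r) with restrict Y? l | restrict Y? r
... | just l' | just r' = just (node l' r')
... | just l' | nothing = just l'
... | nothing | just r' = just r'
... | nothing | nothing = nothing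

-- This is the definition
-- of a caterpillar (l1,l2 a cherry; parent of l_{i+1} = grandparent of l_i)
-- written out on the inductive tree datatype.
data IsCaterpillar {A : Set} : Tree A → Set where
  cat-leaf  : (a : A) → IsCaterpillar (leaf a)
  cat-left  : (a : A) {t : Tree A} → IsCaterpillar t → IsCaterpillar (node (leaf a) t)
  cat-right : (a : A) {t : Tree A} → IsCaterpillar t → IsCaterpillar (node t (leaf a))

IsNCaterpillar : {A : Set} → ℕ → Tree A → Set
IsNCaterpillar n t = IsCaterpillar t × length (leaves t) ≡ n

-- A perfect tree of height h contains an (h+1)-caterpillar: its left spine together with one
-- leaf of each right subtree hanging off the spine. Caterpillars are then doubled: if both
-- halves of a perfect tree of height h+1 carry 2^j disjoint (h+1)-caterpillars, each
-- caterpillar of one half becomes an (h+2)-caterpillar by attaching at the root a leaf of the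
-- other half used by none of its caterpillars. Each half has 2^h − 2^j(h+1) such leaves, enough
-- as long as h+2 ≤ 2^(h−j). So a perfect tree of height h carries 2^j disjoint
-- (h+1)-caterpillars whenever h+1 ≤ 2^(h−j), which holds for j = h − ⌈log₂(h+1)⌉.
module Submission where

open import Defs
open import Data.Nat using (ℕ; suc; _∸_; _^_; _≟_)
open import Data.Nat.Logarithm using (⌈log₂_⌉)
open import Data.Fin using (Fin)
open import Data.List using (List; length)
open import Data.Maybe using (just)
open import Data.Product using (_×_; ∃-syntax; Σ-syntax)
open import Data.Empty using (⊥)
open import Relation.Binary.PropositionalEquality using (_≡_; _≢_)
open import Data.List.Relation.Unary.Unique.Propositional using (Unique)
open import Data.List.Membership.Propositional using (_∈_)
open import Data.List.Membership.DecPropositional _≟_ using (_∈?_)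

open import Level using (0ℓ)
open import Data.Nat using (zero; _+_; _*_; _⊔_; _≤_; _<_; _≤?_; z≤n; s≤s; ⌊_/2⌋; ⌈_/2⌉)
open import Data.Nat.Induction using (<-wellFounded)
open import Data.Nat.Logarithm.Core using (⌈log2⌉)
open import Induction.WellFounded using (Acc; acc)
open import Data.Nat.Properties
open import Data.Maybe using (nothing)
open import Data.List using ([]; _∷_; _++_; _∷ʳ_; [_]; concat; lookup)
open import Data.List.Properties using (length-++; length-++-comm; length-++-≤ˡ; ++-assoc; concat-++)
open import Data.List.Relation.Unary.All as All using (All; []; _∷_)
import Data.List.Relation.Unary.All.Properties as Allₚ
open import Data.List.Relation.Unary.AllPairs using ([]; _∷_)
open import Data.List.Relation.Unary.Any using (here; there)
open import Data.List.Relation.Binary.Disjoint.Propositional using (Disjoint)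
open import Data.List.Relation.Binary.Disjoint.Propositional.Properties using () renaming (sym to Disjoint-sym)
open import Data.List.Relation.Binary.Subset.Propositional using (_⊆_)
open import Data.List.Relation.Binary.Permutation.Propositional using (_↭_; ↭-refl; ↭-sym; ↭⇒↭ₛ; module PermutationReasoning)
open import Data.List.Relation.Binary.Permutation.Propositional.Properties using (++-commutativeMonoid; ++⁺ˡ; ++⁺; ∈-resp-↭; ↭-length)
import Data.List.Relation.Binary.Permutation.Setoid.Properties as ↭ₛ
import Algebra.Solver.CommutativeMonoid as CMSolver
open import Data.List.Membership.Propositional.Properties using (∈-++⁺ˡ; ∈-++⁺ʳ; ∈-++⁻; ∈-lookup; ∈-concat⁺′)
open import Data.Fin using (zero; suc)
open import Data.Sum using (inj₁; inj₂)
open import Data.Product using (_,_; proj₁; proj₂)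
open import Function.Bundles using (_⇔_; mk⇔; Equivalence)
open import Function using (_∘_)
open import Relation.Nullary using (¬_; yes; no; contradiction)
open import Relation.Unary using (Pred; Decidable)
open import Relation.Binary.PropositionalEquality using (refl; sym; trans; cong; cong₂; subst; setoid; module ≡-Reasoning)

private
  variable
    A : Set

Unique-++⁻ˡ : ∀ (xs : List A) {ys} → Unique (xs ++ ys) → Unique xs
Unique-++⁻ˡ []       _          = []
Unique-++⁻ˡ (x ∷ xs) (x∉ ∷ u) = Allₚ.++⁻ˡ xs x∉ ∷ Unique-++⁻ˡ xs u

Unique-++⁻ʳ : ∀ (xs : List A) {ys} → Unique (xs ++ ys) → Unique ys
Unique-++⁻ʳ []       u         = u
Unique-++⁻ʳ (x ∷ xs) (_ ∷ u) = Unique-++⁻ʳ xs u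

Unique-++⇒Disjoint : ∀ (xs : List A) {ys} → Unique (xs ++ ys) → Disjoint xs ys
Unique-++⇒Disjoint (x ∷ xs) (x∉ ∷ _) (here refl  , v∈ys) = All.lookup (Allₚ.++⁻ʳ xs x∉) v∈ys refl
Unique-++⇒Disjoint (x ∷ xs) (_ ∷ u)  (there v∈xs , v∈ys) = Unique-++⇒Disjoint xs u (v∈xs , v∈ys)

Unique-lookup : ∀ (xss : List (List A)) i → Unique (concat xss) → Unique (lookup xss i)
Unique-lookup (xs ∷ xss) zero    u = Unique-++⁻ˡ xs u
Unique-lookup (xs ∷ xss) (suc i) u = Unique-lookup xss i (Unique-++⁻ʳ xs u)

Disjoint-lookup : ∀ (xss : List (List A)) {i j} → i ≢ j → Unique (concat xss) →
                  Disjoint (lookup xss i) (lookup xss j)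
Disjoint-lookup (xs ∷ xss) {zero}  {zero}  i≢j _ = contradiction refl i≢j
Disjoint-lookup (xs ∷ xss) {zero}  {suc j} _   u (v∈xs , v∈xsⱼ) =
  Unique-++⇒Disjoint xs u (v∈xs , ∈-concat⁺′ v∈xsⱼ (∈-lookup {xs = xss} j))
Disjoint-lookup (xs ∷ xss) {suc i} {zero}  _   u (v∈xsᵢ , v∈xs) =
  Unique-++⇒Disjoint xs u (v∈xs , ∈-concat⁺′ v∈xsᵢ (∈-lookup {xs = xss} i))
Disjoint-lookup (xs ∷ xss) {suc i} {suc j} i≢j u =
  Disjoint-lookup xss (i≢j ∘ cong suc) (Unique-++⁻ʳ xs u)

Unique-resp-↭ : ∀ {xs ys : List A} → xs ↭ ys → Unique xs → Unique ys
Unique-resp-↭ {A} = ↭ₛ.Unique-resp-↭ (setoid A) ∘ ↭⇒↭ₛ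

++-interchange : ∀ (a b c d : List A) → (a ++ b) ++ (c ++ d) ↭ (a ++ c) ++ (b ++ d)
++-interchange {A} = solve 4 (λ a b c d → (a ⊕ b) ⊕ (c ⊕ d) ⊜ (a ⊕ c) ⊕ (b ⊕ d)) ↭-refl
  where open CMSolver (++-commutativeMonoid {A = A})

++-swap-tails : ∀ (a b c d : List A) → (a ++ b) ++ (c ++ d) ↭ (a ++ d) ++ (c ++ b)
++-swap-tails {A} = solve 4 (λ a b c d → (a ⊕ b) ⊕ (c ⊕ d) ⊜ (a ⊕ d) ⊕ (c ⊕ b)) ↭-refl
  where open CMSolver (++-commutativeMonoid {A = A})

length-concat : ∀ {n} {xss : List (List A)} → All (λ xs → length xs ≡ n) xss → length (concat xss) ≡ length xss * n
length-concat                     []           = refl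
length-concat {xss = xs ∷ xss} (refl ∷ len≡) = trans (length-++ xs) (cong (length xs +_) (length-concat len≡))

module _ {Q : Pred A 0ℓ} (Q? : Decidable Q) where

  restrict-node : ∀ {l r l′ r′} → restrict Q? l ≡ just l′ → restrict Q? r ≡ just r′ →
                  restrict Q? (node l r) ≡ just (node l′ r′)
  restrict-node l≡ r≡ rewrite l≡ | r≡ = refl

  restrict-nothing : ∀ t → (∀ {x} → x ∈ leaves t → ¬ Q x) → restrict Q? t ≡ nothing
  restrict-nothing (leaf a) ¬Q with Q? a
  ... | yes qa = contradiction qa (¬Q (here refl))
  ... | no _   = refl
  restrict-nothing (node l r) ¬Q
    rewrite restrict-nothing l (¬Q ∘ ∈-++⁺ˡ) | restrict-nothing r (¬Q ∘ ∈-++⁺ʳ (leaves l)) = refl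

  unselected : ∀ {xs : List A} {a} → ¬ a ∈ xs → (∀ {x} → x ∈ xs → Q x → x ≡ a) → ∀ {x} → x ∈ xs → ¬ Q x
  unselected a∉ only-a x∈ qx = a∉ (subst (_∈ _) (only-a x∈ qx) x∈)

  restrict-singleton : ∀ t {a} → Unique (leaves t) → a ∈ leaves t → Q a →
                       (∀ {x} → x ∈ leaves t → Q x → x ≡ a) → restrict Q? t ≡ just (leaf a)
  restrict-singleton (leaf a) _ (here refl) qa _ with Q? a
  ... | yes _  = refl
  ... | no ¬qa = contradiction qa ¬qa
  restrict-singleton (node l r) u a∈ qa only-a with ∈-++⁻ (leaves l) a∈
  ... | inj₁ a∈l
    rewrite restrict-singleton l (Unique-++⁻ˡ (leaves l) u) a∈l qa (only-a ∘ ∈-++⁺ˡ)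
          | restrict-nothing r (unselected (λ a∈r → Unique-++⇒Disjoint (leaves l) u (a∈l , a∈r))
                                           (only-a ∘ ∈-++⁺ʳ (leaves l)))
          = refl
  ... | inj₂ a∈r
    rewrite restrict-nothing l (unselected (λ a∈l → Unique-++⇒Disjoint (leaves l) u (a∈l , a∈r))
                                           (only-a ∘ ∈-++⁺ˡ))
          | restrict-singleton r (Unique-++⁻ʳ (leaves l) u) a∈r qa (only-a ∘ ∈-++⁺ʳ (leaves l))
          = refl

restrict-cong : ∀ {Q R : Pred A 0ℓ} (Q? : Decidable Q) (R? : Decidable R) t →
                (∀ {x} → x ∈ leaves t → Q x ⇔ R x) → restrict Q? t ≡ restrict R? t
restrict-cong Q? R? (leaf a) Q⇔R with Q? a | R? a
... | yes _  | yes _  = refl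
... | no _   | no _   = refl
... | yes qa | no ¬ra = contradiction (Equivalence.to (Q⇔R (here refl)) qa) ¬ra
... | no ¬qa | yes ra = contradiction (Equivalence.from (Q⇔R (here refl)) ra) ¬qa
restrict-cong Q? R? (node l r) Q⇔R
  rewrite restrict-cong Q? R? l (Q⇔R ∘ ∈-++⁺ˡ) | restrict-cong Q? R? r (Q⇔R ∘ ∈-++⁺ʳ (leaves l)) = refl

restrict-∷ʳ : ∀ (S T : Tree ℕ) {c b} → Unique (leaves T) → Disjoint (leaves S) (leaves T) →
              c ⊆ leaves S → b ∈ leaves T →
              restrict (_∈? c ∷ʳ b) S ≡ restrict (_∈? c) S × restrict (_∈? c ∷ʳ b) T ≡ just (leaf b)
restrict-∷ʳ S T {c} {b} uT S#T c⊆S b∈T =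
  restrict-cong (_∈? c ∷ʳ b) (_∈? c) S (λ x∈S → mk⇔ (∈c∷ʳb⇒∈c x∈S) ∈-++⁺ˡ) ,
  restrict-singleton (_∈? c ∷ʳ b) T uT b∈T (∈-++⁺ʳ c (here refl)) ∈c∷ʳb⇒≡b
  where
  ∈c∷ʳb⇒∈c : ∀ {x} → x ∈ leaves S → x ∈ c ∷ʳ b → x ∈ c
  ∈c∷ʳb⇒∈c x∈S x∈ with ∈-++⁻ c x∈
  ... | inj₁ x∈c         = x∈c
  ... | inj₂ (here refl) = contradiction (x∈S , b∈T) S#T
  ∈c∷ʳb⇒≡b : ∀ {x} → x ∈ leaves T → x ∈ c ∷ʳ b → x ≡ b
  ∈c∷ʳb⇒≡b x∈T x∈ with ∈-++⁻ c x∈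
  ... | inj₁ x∈c         = contradiction (c⊆S x∈c , x∈T) S#T
  ... | inj₂ (here refl) = refl

record CaterpillarOn (T : Tree ℕ) (n : ℕ) (Y : List ℕ) : Set where
  field
    size        : length Y ≡ n
    ⊆leaves     : Y ⊆ leaves T
    restriction : Tree ℕ
    restrict≡   : restrict (_∈? Y) T ≡ just restriction
    caterpillar : IsNCaterpillar n restriction

length-∷ʳ : ∀ (c : List A) {b n} → length c ≡ n → length (c ∷ʳ b) ≡ suc n
length-∷ʳ c {b} refl = length-++-comm c [ b ]

∷ʳ-⊆ : ∀ {c b} {X : List A} → c ⊆ X → b ∈ X → c ∷ʳ b ⊆ X
∷ʳ-⊆ {c = c} c⊆X b∈X x∈ with ∈-++⁻ c x∈
... | inj₁ x∈c         = c⊆X x∈c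
... | inj₂ (here refl) = b∈X

module _ {L R : Tree ℕ} (u : Unique (leaves (node L R))) where

  private
    uL : Unique (leaves L)
    uL = Unique-++⁻ˡ (leaves L) u

    uR : Unique (leaves R)
    uR = Unique-++⁻ʳ (leaves L) u

    L#R : Disjoint (leaves L) (leaves R)
    L#R = Unique-++⇒Disjoint (leaves L) u

  extendʳ : ∀ {n c b} → CaterpillarOn L n c → b ∈ leaves R → CaterpillarOn (node L R) (suc n) (c ∷ʳ b)
  extendʳ {c = c} {b} C b∈R with restrict-∷ʳ L R uR L#R (CaterpillarOn.⊆leaves C) b∈R
  ... | L≡ , R≡ = record
    { size        = length-∷ʳ c size
    ; ⊆leaves     = ∷ʳ-⊆ (∈-++⁺ˡ ∘ ⊆leaves) (∈-++⁺ʳ (leaves L) b∈R)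
    ; restriction = node restriction (leaf b)
    ; restrict≡   = restrict-node (_∈? c ∷ʳ b) {L} {R} (trans L≡ restrict≡) R≡
    ; caterpillar = cat-right b (proj₁ caterpillar) , length-∷ʳ (leaves restriction) (proj₂ caterpillar)
    }
    where open CaterpillarOn C

  extendˡ : ∀ {n c b} → CaterpillarOn R n c → b ∈ leaves L → CaterpillarOn (node L R) (suc n) (c ∷ʳ b)
  extendˡ {c = c} {b} C b∈L with restrict-∷ʳ R L uL (Disjoint-sym L#R) (CaterpillarOn.⊆leaves C) b∈L
  ... | R≡ , L≡ = record
    { size        = length-∷ʳ c size
    ; ⊆leaves     = ∷ʳ-⊆ (∈-++⁺ʳ (leaves L) ∘ ⊆leaves) (∈-++⁺ˡ b∈L)
    ; restriction = node (leaf b) restriction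
    ; restrict≡   = restrict-node (_∈? c ∷ʳ b) {L} {R} L≡ (trans R≡ restrict≡)
    ; caterpillar = cat-left b (proj₁ caterpillar) , cong suc (proj₂ caterpillar)
    }
    where open CaterpillarOn C

1≤length-leaves : ∀ (t : Tree A) → 1 ≤ length (leaves t)
1≤length-leaves (leaf _)   = ≤-refl
1≤length-leaves (node l r) = ≤-trans (1≤length-leaves l) (length-++-≤ˡ (leaves l))

data Perfect {A : Set} : ℕ → Tree A → Set where
  leaf : ∀ a → Perfect 0 (leaf a)
  node : ∀ {h l r} → Perfect h l → Perfect h r → Perfect (suc h) (node l r)

Perfect⇒length≡2^h : ∀ {h} {t : Tree A} → Perfect h t → length (leaves t) ≡ 2 ^ h
Perfect⇒length≡2^h (leaf a) = refl
Perfect⇒length≡2^h (node {h} {l} {r} pl pr) = begin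
  length (leaves l ++ leaves r)          ≡⟨ length-++ (leaves l) ⟩
  length (leaves l) + length (leaves r)  ≡⟨ cong₂ _+_ (Perfect⇒length≡2^h pl) (Perfect⇒length≡2^h pr) ⟩
  2 ^ h + 2 ^ h                          ≡⟨ cong (2 ^ h +_) (+-identityʳ (2 ^ h)) ⟨
  2 ^ suc h                              ∎
  where open ≡-Reasoning

length≤2^height : ∀ (t : Tree A) → length (leaves t) ≤ 2 ^ height t
length≤2^height (leaf _)   = ≤-refl
length≤2^height (node l r) = begin
  length (leaves l ++ leaves r)          ≡⟨ length-++ (leaves l) ⟩
  length (leaves l) + length (leaves r)  ≤⟨ +-mono-≤ (bound l (m≤m⊔n _ _)) (bound r (m≤n⊔m _ _)) ⟩
  2 ^ hₘ + 2 ^ hₘ                         ≡⟨ cong (2 ^ hₘ +_) (+-identityʳ (2 ^ hₘ)) ⟨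
  2 ^ suc hₘ                             ∎
  where
  open ≤-Reasoning
  hₘ : ℕ
  hₘ = height l ⊔ height r
  bound : ∀ t → height t ≤ hₘ → length (leaves t) ≤ 2 ^ hₘ
  bound t le = ≤-trans (length≤2^height t) (^-monoʳ-≤ 2 le)

m≤o⇒n≤o⇒m+n≡o+o⇒m≡o×n≡o : ∀ {m n o} → m ≤ o → n ≤ o → m + n ≡ o + o → m ≡ o × n ≡ o
m≤o⇒n≤o⇒m+n≡o+o⇒m≡o×n≡o {m} {n} {o} m≤o n≤o eq =
  ≤-antisym m≤o (+-cancelʳ-≤ o o m (≤-trans (≤-reflexive (sym eq)) (+-monoʳ-≤ m n≤o))) ,
  ≤-antisym n≤o (+-cancelˡ-≤ o o n (≤-trans (≤-reflexive (sym eq)) (+-monoˡ-≤ n m≤o)))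

balanced⇒perfect : ∀ h (t : Tree A) → length (leaves t) ≡ 2 ^ h → height t ≤ h → Perfect h t
balanced⇒perfect zero    (leaf a)   _     _ = leaf a
balanced⇒perfect (suc h) (leaf a)   1≡2^h _ with m^n≡1⇒n≡0∨m≡1 2 (suc h) (sym 1≡2^h)
... | inj₁ ()
... | inj₂ ()
balanced⇒perfect (suc h) (node l r) len≡ (s≤s height≤) =
  node (balanced⇒perfect h l (proj₁ halves) hl≤h) (balanced⇒perfect h r (proj₂ halves) hr≤h)
  where
  hl≤h : height l ≤ h
  hl≤h = m⊔n≤o⇒m≤o (height l) (height r) height≤
  hr≤h : height r ≤ h
  hr≤h = m⊔n≤o⇒n≤o (height l) (height r) height≤
  halves : length (leaves l) ≡ 2 ^ h × length (leaves r) ≡ 2 ^ h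
  halves = m≤o⇒n≤o⇒m+n≡o+o⇒m≡o×n≡o
    (≤-trans (length≤2^height l) (^-monoʳ-≤ 2 hl≤h))
    (≤-trans (length≤2^height r) (^-monoʳ-≤ 2 hr≤h))
    (trans (sym (length-++ (leaves l))) (trans len≡ (cong (2 ^ h +_) (+-identityʳ (2 ^ h)))))

record Packing (T : Tree ℕ) (n : ℕ) : Set where
  field
    caterpillars : List (List ℕ)
    rest         : List ℕ
    partition    : concat caterpillars ++ rest ↭ leaves T
    embedded     : All (CaterpillarOn T n) caterpillars

  rest⊆leaves : rest ⊆ leaves T
  rest⊆leaves = ∈-resp-↭ partition ∘ ∈-++⁺ʳ (concat caterpillars)

  length-rest : length rest + length caterpillars * n ≡ length (leaves T)
  length-rest = begin
    length rest + length caterpillars * n             ≡⟨ cong (length rest +_) (length-concat (All.map CaterpillarOn.size embedded)) ⟨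
    length rest + length (concat caterpillars)        ≡⟨ +-comm (length rest) _ ⟩
    length (concat caterpillars) + length rest        ≡⟨ length-++ (concat caterpillars) ⟨
    length (concat caterpillars ++ rest)              ≡⟨ ↭-length partition ⟩
    length (leaves T)                                 ∎
    where open ≡-Reasoning

open Packing

emptyPacking : ∀ T {n} → Packing T n
emptyPacking T = record { caterpillars = [] ; rest = leaves T ; partition = ↭-refl ; embedded = [] }

attach : ∀ {P P′ : List A → Set} {Q : A → Set} → (∀ {c b} → P c → Q b → P′ (c ∷ʳ b)) →
         ∀ {cs bs} → All P cs → All Q bs → length cs ≤ length bs →
         ∃[ cs′ ] ∃[ ds ] All P′ cs′ × length cs′ ≡ length cs × concat cs′ ++ ds ↭ concat cs ++ bs
attach ext {bs = bs} [] _ _ = [] , bs , [] , refl , ↭-refl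
attach ext {c ∷ cs} {b ∷ bs} (pc ∷ pcs) (qb ∷ qbs) (s≤s len≤) with attach ext pcs qbs len≤
... | cs′ , ds , p′cs′ , len≡ , perm = c ∷ʳ b ∷ cs′ , ds , ext pc qb ∷ p′cs′ , cong suc len≡ , (begin
  ((c ∷ʳ b) ++ concat cs′) ++ ds    ≡⟨ ++-assoc (c ∷ʳ b) (concat cs′) ds ⟩
  (c ∷ʳ b) ++ (concat cs′ ++ ds)    ↭⟨ ++⁺ˡ (c ∷ʳ b) perm ⟩
  (c ++ [ b ]) ++ (concat cs ++ bs)  ↭⟨ ++-interchange c [ b ] (concat cs) bs ⟩
  (c ++ concat cs) ++ (b ∷ bs)      ∎)
  where open PermutationReasoning

combine : ∀ {L R n} → Unique (leaves (node L R)) → (P : Packing L n) (Q : Packing R n) →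
          length (caterpillars P) ≤ length (rest Q) → length (caterpillars Q) ≤ length (rest P) →
          Σ[ S ∈ Packing (node L R) (suc n) ]
            length (caterpillars S) ≡ length (caterpillars P) + length (caterpillars Q)
combine {L} {R} u P Q P≤Q Q≤P
  with attach (extendʳ u) (embedded P) (All.tabulate (rest⊆leaves Q)) P≤Q
     | attach (extendˡ u) (embedded Q) (All.tabulate (rest⊆leaves P)) Q≤P
... | cs₁ , ds₁ , ok₁ , len₁ , perm₁ | cs₂ , ds₂ , ok₂ , len₂ , perm₂ = S , count
  where
  S : Packing (node L R) _
  S = record
    { caterpillars = cs₁ ++ cs₂
    ; rest         = ds₁ ++ ds₂
    ; partition    = begin
        concat (cs₁ ++ cs₂) ++ (ds₁ ++ ds₂)              ≡⟨ cong (_++ (ds₁ ++ ds₂)) (concat-++ cs₁ cs₂) ⟨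
        (concat cs₁ ++ concat cs₂) ++ (ds₁ ++ ds₂)        ↭⟨ ++-interchange (concat cs₁) (concat cs₂) ds₁ ds₂ ⟩
        (concat cs₁ ++ ds₁) ++ (concat cs₂ ++ ds₂)        ↭⟨ ++⁺ perm₁ perm₂ ⟩
        (concat (caterpillars P) ++ rest Q) ++ (concat (caterpillars Q) ++ rest P)
                                                          ↭⟨ ++-swap-tails (concat (caterpillars P)) (rest Q) _ (rest P) ⟩
        (concat (caterpillars P) ++ rest P) ++ (concat (caterpillars Q) ++ rest Q)
                                                          ↭⟨ ++⁺ (partition P) (partition Q) ⟩
        leaves L ++ leaves R                              ∎
    ; embedded     = Allₚ.++⁺ ok₁ ok₂
    }
    where open PermutationReasoning
  count : length (cs₁ ++ cs₂) ≡ length (caterpillars P) + length (caterpillars Q)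
  count = trans (length-++ cs₁) (cong₂ _+_ len₁ len₂)

spine : ∀ {h T} → Unique (leaves T) → Perfect h T → Σ[ P ∈ Packing T (suc h) ] length (caterpillars P) ≡ 1
spine u (leaf a) = packing , refl
  where
  singleton : CaterpillarOn (leaf a) 1 [ a ]
  singleton = record
    { size        = refl
    ; ⊆leaves     = λ x∈ → x∈
    ; restriction = leaf a
    ; restrict≡   = restrict-singleton (_∈? [ a ]) (leaf a) u (here refl) (here refl) (λ where (here refl) _ → refl)
    ; caterpillar = cat-leaf a , refl
    }
  packing : Packing (leaf a) 1
  packing = record { caterpillars = [ [ a ] ] ; rest = [] ; partition = ↭-refl ; embedded = singleton ∷ [] }
spine {T = node L R} u (node pL pR)
  with P , #P≡1 ← spine (Unique-++⁻ˡ (leaves L) u) pL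
  with S , #S≡ ← combine u P (emptyPacking R) (≤-trans (≤-reflexive #P≡1) (1≤length-leaves R)) z≤n
  = S , trans #S≡ (trans (+-identityʳ _) #P≡1)

r+m*s≡m*t⇒s<t⇒m≤r : ∀ {r m s t} → r + m * s ≡ m * t → s < t → m ≤ r
r+m*s≡m*t⇒s<t⇒m≤r {r} {m} {s} {t} eq s<t = +-cancelʳ-≤ (m * s) m r (begin
  m + m * s  ≡⟨ *-suc m s ⟨
  m * suc s  ≤⟨ *-monoʳ-≤ m s<t ⟩
  m * t      ≡⟨ eq ⟨
  r + m * s  ∎)
  where open ≤-Reasoning

spare-leaves : ∀ {h j S} → j ≤ h → suc (suc h) ≤ 2 ^ (h ∸ j) → Perfect h S →
               (P : Packing S (suc h)) → length (caterpillars P) ≡ 2 ^ j → 2 ^ j ≤ length (rest P)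
spare-leaves {h} {j} {S} j≤h fits p P #P = r+m*s≡m*t⇒s<t⇒m≤r (begin
  length (rest P) + 2 ^ j * suc h                   ≡⟨ cong (λ m → length (rest P) + m * suc h) #P ⟨
  length (rest P) + length (caterpillars P) * suc h ≡⟨ length-rest P ⟩
  length (leaves S)                                 ≡⟨ Perfect⇒length≡2^h p ⟩
  2 ^ h                                             ≡⟨ cong (2 ^_) (m+[n∸m]≡n j≤h) ⟨
  2 ^ (j + (h ∸ j))                                 ≡⟨ ^-distribˡ-+-* 2 j (h ∸ j) ⟩
  2 ^ j * 2 ^ (h ∸ j)                               ∎) fits
  where open ≡-Reasoning

perfect-packing : ∀ {h} {T : Tree ℕ} j → j ≤ h → suc h ≤ 2 ^ (h ∸ j) → Unique (leaves T) → Perfect h T →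
                  Σ[ P ∈ Packing T (suc h) ] length (caterpillars P) ≡ 2 ^ j
perfect-packing zero _ _ u p = spine u p
perfect-packing {suc h} {node L R} (suc j) (s≤s j≤h) fits u (node pL pR)
  with P , #P ← perfect-packing j j≤h (≤-trans (n≤1+n _) fits) (Unique-++⁻ˡ (leaves L) u) pL
  with Q , #Q ← perfect-packing j j≤h (≤-trans (n≤1+n _) fits) (Unique-++⁻ʳ (leaves L) u) pR
  with S , #S ← combine u P Q (≤-trans (≤-reflexive #P) (spare-leaves j≤h fits pR Q #Q))
                              (≤-trans (≤-reflexive #Q) (spare-leaves j≤h fits pL P #P))
  = S , trans #S (cong₂ _+_ #P (trans #Q (sym (+-identityʳ (2 ^ j)))))

n≤2^⌈log₂n⌉ : ∀ n → n ≤ 2 ^ ⌈log₂ n ⌉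
n≤2^⌈log₂n⌉ n = go n (<-wellFounded n)
  where
  go : ∀ n (acc : Acc _<_ n) → n ≤ 2 ^ ⌈log2⌉ n acc
  go zero                _        = z≤n
  go (suc zero)          _        = ≤-refl
  go (suc (suc n)) (acc rs) = begin
    2 + n                          ≡⟨ cong (2 +_) (⌊n/2⌋+⌈n/2⌉≡n n) ⟨
    2 + (⌊ n /2⌋ + ⌈ n /2⌉)        ≤⟨ +-monoʳ-≤ 2 (+-monoˡ-≤ ⌈ n /2⌉ (⌊n/2⌋≤⌈n/2⌉ n)) ⟩
    2 + (⌈ n /2⌉ + ⌈ n /2⌉)        ≡⟨ cong suc (+-suc ⌈ n /2⌉ ⌈ n /2⌉) ⟨
    suc ⌈ n /2⌉ + suc ⌈ n /2⌉      ≤⟨ +-mono-≤ half half ⟩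
    2 ^ k + 2 ^ k                  ≡⟨ cong (2 ^ k +_) (+-identityʳ (2 ^ k)) ⟨
    2 ^ suc k                      ∎
    where
    open ≤-Reasoning
    k : ℕ
    k = ⌈log2⌉ (suc ⌈ n /2⌉) (rs (⌈n/2⌉<n n))
    half : suc ⌈ n /2⌉ ≤ 2 ^ k
    half = go (suc ⌈ n /2⌉) (rs (⌈n/2⌉<n n))

n<2^n : ∀ n → n < 2 ^ n
n<2^n zero    = ≤-refl
n<2^n (suc n) = begin-strict
  suc n          ≤⟨ n<2^n n ⟩
  2 ^ n          <⟨ m<m+n (2 ^ n) (m^n>0 2 n) ⟩
  2 ^ n + 2 ^ n  ≡⟨ cong (2 ^ n +_) (+-identityʳ (2 ^ n)) ⟨
  2 ^ suc n      ∎
  where open ≤-Reasoning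

1+h≤2^[h∸[h∸⌈log₂[1+h]⌉]] : ∀ h → suc h ≤ 2 ^ (h ∸ (h ∸ ⌈log₂ suc h ⌉))
1+h≤2^[h∸[h∸⌈log₂[1+h]⌉]] h with ⌈log₂ suc h ⌉ ≤? h
... | yes log≤h rewrite m∸[m∸n]≡n log≤h                   = n≤2^⌈log₂n⌉ (suc h)
... | no  log≰h rewrite m≤n⇒m∸n≡0 (<⇒≤ (≰⇒> log≰h)) = n<2^n h

DisjointCaterpillars : Tree ℕ → ℕ → ℕ → Set
DisjointCaterpillars T n m =
  Σ[ Y ∈ (Fin m → List ℕ) ]
    ((∀ s → Unique (Y s) × length (Y s) ≡ n × (∀ x → x ∈ Y s → x ∈ leaves T))
    × (∀ s t → s ≢ t → ∀ x → x ∈ Y s → x ∈ Y t → ⊥)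
    × (∀ s → ∃[ C ] (restrict (_∈? Y s) T ≡ just C × IsNCaterpillar n C)))

packing⇒disjoint : ∀ {T n} → Unique (leaves T) → (P : Packing T n) →
                   DisjointCaterpillars T n (length (caterpillars P))
packing⇒disjoint {T} {n} u P =
  lookup cats ,
  (λ s → Unique-lookup cats s unique , size (at s) , λ _ → ⊆leaves (at s)) ,
  (λ s t s≢t _ x∈s x∈t → Disjoint-lookup cats s≢t unique (x∈s , x∈t)) ,
  (λ s → restriction (at s) , restrict≡ (at s) , caterpillar (at s))
  where
  open CaterpillarOn
  cats : List (List ℕ)
  cats = caterpillars P
  at : ∀ s → CaterpillarOn T n (lookup cats s)
  at s = All.lookup (embedded P) (∈-lookup s)
  unique : Unique (concat cats)
  unique = Unique-++⁻ˡ (concat cats) (Unique-resp-↭ (↭-sym (partition P)) u)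

lemma6 : (n : ℕ) → 1 Data.Nat.≤ n → (T : Tree ℕ) → IsPhylogenetic T → IsBalanced (n ∸ 1) T →
    Σ[ Y ∈ (Fin (2 ^ (n ∸ 1 ∸ ⌈log₂ n ⌉)) → List ℕ) ]
      ((∀ s → Unique (Y s) × length (Y s) ≡ n × (∀ x → x ∈ Y s → x ∈ leaves T))
      × (∀ s t → s ≢ t → ∀ x → x ∈ Y s → x ∈ Y t → ⊥)
      × (∀ s → ∃[ C ] (restrict (_∈? Y s) T ≡ just C × IsNCaterpillar n C)))
lemma6 (suc h) _ T u (#leaves , height≡h)
  with P , #P ← perfect-packing (h ∸ ⌈log₂ suc h ⌉) (m∸n≤m h ⌈log₂ suc h ⌉) (1+h≤2^[h∸[h∸⌈log₂[1+h]⌉]] h) u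
                                (balanced⇒perfect h T #leaves (≤-reflexive height≡h))
  = subst (DisjointCaterpillars T (suc h)) #P (packing⇒disjoint u P)
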